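{- Let $S\ge3$ be odd, and consider the process with $G^{(0)}=G_S$, thresholds $\alpha=\beta=2$, energy $\mathcal{E}^{(t)}(u,v)=|N_{G^{(t)}}(u)\cap N_{G^{(t)}}(v)|$, and interaction set $C^{(t)}$ consisting of all pairs of distinct vertices at distance at most $2$ in $G^{(t)}$. Then the process does not converge (there is no $t$ with $G^{(t)}=G^{(t+1)}$), and its cycle size is $2k$, where $k>0$ is the smallest integer such that $2^k\equiv\pm1\pmod S$.
   Context: $G_S$ is the graph on $\{0,\dots,S-1\}^2$ in which $(x,y)$ is adjacent to $(x,y\pm1\bmod S)$ and $(x\pm1\bmod S,y)$. Process: $G^{(t+1)}$ on the same vertex set is defined by: for each pair $\{u,v\}\in C^{(t)}$, it is an edge of $G^{(t+1)}$ iff $\mathcal{E}^{(t)}(u,v)\ge2$; pairs not in $C^{(t)}$ keep their status. The sequence $(G^{(t)})$ is eventually periodic; the cycle size is the least $p\ge1$ with $G^{(t+p)}=G^{(t)}$ for all sufficiently large $t$. -}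

module Defs where

open import Data.Nat using (ℕ; zero; suc; _+_; _*_; _∸_; _^_; _≤_; _<_; _≤ᵇ_; _≡ᵇ_)
open import Data.Nat.Divisibility using (_∣_)
open import Data.Fin using (Fin; toℕ)
open import Data.Fin.Properties using () renaming (_≟_ to _≟F_)
open import Data.Bool using (Bool; true; false; _∧_; _∨_; not; if_then_else_)
open import Data.List using (List; []; _∷_; concatMap; map; length; filter)
open import Data.List using (allFin)
open import Data.Product using (_×_; _,_; ∃-syntax; Σ)
open import Data.Sum using (_⊎_)
open import Relation.Nullary using (¬_)
open import Relation.Nullary.Decidable using (⌊_⌋)
open import Relation.Binary.PropositionalEquality using (_≡_)

V : ℕ → Set
V S = Fin S × Fin S

Graph : ℕ → Set
Graph S = V S → V S → Bool

vertices : (S : ℕ) → List (V S)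
vertices S = concatMap (λ x → map (λ y → (x , y)) (allFin S)) (allFin S)

_==V_ : ∀ {S} → V S → V S → Bool
_==V_ (x , y) (x' , y') = ⌊ x ≟F x' ⌋ ∧ ⌊ y ≟F y' ⌋

cycSucc : ∀ {S} → Fin S → Fin S → Bool
cycSucc {S} a b = (toℕ b ≡ᵇ suc (toℕ a)) ∨ ((toℕ a ≡ᵇ S ∸ 1) ∧ (toℕ b ≡ᵇ 0))

cycAdj : ∀ {S} → Fin S → Fin S → Bool
cycAdj a b = cycSucc a b ∨ cycSucc b a

torus : (S : ℕ) → Graph S
torus S (x , y) (x' , y') =
  (⌊ x ≟F x' ⌋ ∧ cycAdj y y') ∨ (⌊ y ≟F y' ⌋ ∧ cycAdj x x')

energy : ∀ {S} → Graph S → V S → V S → ℕ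
energy {S} G u v = length (filter (λ w → Data.Bool._≟_ (G u w ∧ G v w) true) (vertices S))

-- interaction set C: pairs of distinct vertices at distance ≤ 2 in G
-- (distance ≤ 2 for distinct u, v: adjacent, or having a common neighbour)
inC : ∀ {S} → Graph S → V S → V S → Bool
inC G u v = not (u ==V v) ∧ (G u v ∨ (1 ≤ᵇ energy G u v))

step : ∀ {S} → Graph S → Graph S
step G u v = if inC G u v then (2 ≤ᵇ energy G u v) else G u v

process : (S : ℕ) → ℕ → Graph S
process S zero = torus S
process S (suc t) = step (process S t)

_≈G_ : ∀ {S} → Graph S → Graph S → Set
G ≈G H = ∀ u v → G u v ≡ H u v

EventuallyPeriodicWith : ∀ {S} → (ℕ → Graph S) → ℕ → Set
EventuallyPeriodicWith Gs p = ∃[ T ] (∀ t → T ≤ t → Gs (t + p) ≈G Gs t)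

IsCycleSize : ∀ {S} → (ℕ → Graph S) → ℕ → Set
IsCycleSize Gs p =
  (1 ≤ p) × EventuallyPeriodicWith Gs p
  × (∀ q → 1 ≤ q → q < p → ¬ EventuallyPeriodicWith Gs q)

PowTwoPM1 : ℕ → ℕ → Set
PowTwoPM1 S k = (S ∣ (2 ^ k ∸ 1)) ⊎ (S ∣ (2 ^ k + 1))

module Submission where

-- Identify V S with ℤ² modulo S, so that u ~ v in G_S iff
-- v - u is congruent to a unit vector ±e₁, ±e₂.  Let φ be the map on vertices
-- induced by rot(p, q) = (p + q, p - q); as S is odd, 2 is invertible and φ is
-- a bijection.  Key lemma (first-step): G^(1)(φu, φv) = G_S(u, v).  The common
-- neighbours of φu, φv are the φu + c (c a unit vector) with c - rot(v - u) a
-- unit vector, and there are two of them exactly when v - u is a unit vector;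
-- the core of this is a finite check on small vectors, done by computation.
-- A step commutes with relabelling along a bijection, so G^(t) is G_S relabelled
-- along φ^t and the process has period p iff G_S is φ^p-invariant (Conjugacy).
-- In coordinates rot² = 2: odd powers of φ break an edge, and φ^(2j) preserves
-- G_S iff 2^j ≡ ±1 (mod S).

open import Defs
open import Data.Nat using (ℕ; zero; suc; _+_; _*_; _^_; _∸_; _≤_; _<_; _≤ᵇ_; s≤s; z≤n; NonZero;
                            >-nonZero; >-nonZero⁻¹)
import Data.Nat.Properties as ℕP
open import Data.Nat.Divisibility using (_∣_; ∣⇒≤; ∣1⇒≡1; m∣m*n)
open import Data.Nat.GeneralisedArithmetic using (fold)
open import Data.Integer as ℤ using (ℤ; +_; _-_; -_; 0ℤ; 1ℤ; -1ℤ)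
import Data.Integer.Properties as ℤP
open import Data.Integer.DivMod using (_%ℕ_; _/ℕ_; n%ℕd<d; a≡a%ℕn+[a/ℕn]*n)
open import Data.Integer.Divisibility.Signed using (divides; ∣⇒∣ᵤ; ∣ᵤ⇒∣; ∣m∣n⇒∣m+n; ∣m⇒∣-m; ∣n⇒∣m*n)
  renaming (_∣_ to _∣ℤ_)
open import Data.Integer.Tactic.RingSolver using (solve-∀)
open import Data.Bool using (Bool; true; false; T; _∧_; _∨_; not; if_then_else_)
open import Data.Bool.Properties using (T-≡; ⇔→≡; T-∨; T-∧)
open import Data.Empty using (⊥; ⊥-elim)
open import Data.Unit using (tt)
open import Data.Fin using (Fin; toℕ; fromℕ<)
import Data.Fin.Properties as FinP
open import Data.Product using (_×_; _,_; proj₁; proj₂; ∃; ∃-syntax)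
import Data.Product.Properties as ×P
open import Data.Product.Relation.Binary.Pointwise.NonDependent using (Pointwise; ×-setoid)
open import Data.Sum as Sum using (_⊎_; inj₁; inj₂; [_,_]′)
open import Data.List using (List; []; _∷_; _++_; map; filter; length; allFin; concatMap; cartesianProduct)
open import Data.List.Membership.Propositional using (_∈_)
open import Data.List.Membership.Propositional.Properties
  using (∈-filter⁺; ∈-filter⁻; ∈-map⁺; ∈-map⁻; ∈-allFin; ∈-cartesianProduct⁺)
open import Data.List.Membership.Propositional.Properties.WithK using (unique∧set⇒bag)
open import Data.List.Relation.Binary.BagAndSetEquality using (∼bag⇒↭)
open import Data.List.Relation.Binary.Permutation.Propositional.Properties using (↭-length)
open import Data.List.Relation.Unary.All as All using (All; []; _∷_; all?)
open import Data.List.Relation.Unary.Any as Any using (Any; here; there)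
import Data.List.Relation.Unary.Any.Properties as AnyP
open import Data.List.Relation.Unary.AllPairs as AllPairs using (AllPairs; []; _∷_; allPairs?)
import Data.List.Relation.Unary.AllPairs.Properties as AllPairsP
open import Data.List.Relation.Unary.Unique.Propositional using (Unique)
import Data.List.Relation.Unary.Unique.Propositional.Properties as UniqueP
open import Function using (_∘_; _⇔_; mk⇔; Equivalence)
open import Function.Properties.Equivalence using (⇔-setoid)
open import Level using (0ℓ)
open import Relation.Nullary using (¬_; Dec; yes; no)
open import Relation.Nullary.Decidable using (⌊_⌋; toWitness; fromWitness; _⊎-dec_)
open import Relation.Binary.Bundles using (Setoid)
open import Relation.Binary.PropositionalEquality
open Equivalence using (to; from)

module Counting where

  private variable
    A B : Set

  count : (A → Bool) → List A → ℕ
  count f xs = length (filter (λ a → Data.Bool._≟_ (f a) true) xs)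

  count-map : (f : A → Bool) (g : B → A) (xs : List B) →
              count f (map g xs) ≡ count (f ∘ g) xs
  count-map f g [] = refl
  count-map f g (x ∷ xs) with f (g x)
  ... | true  = cong suc (count-map f g xs)
  ... | false = count-map f g xs

  count-cong : ∀ {f g : A → Bool} {xs} → All (λ x → f x ≡ g x) xs → count f xs ≡ count g xs
  count-cong [] = refl
  count-cong {f = f} {g} {x ∷ xs} (eq ∷ eqs) with f x | g x | eq
  ... | true  | .true  | refl = cong suc (count-cong eqs)
  ... | false | .false | refl = count-cong eqs

  -- Two duplicate-free lists containing the same passing elements have the
  -- same count: their filtered sublists are permutations of each other.
  count-unique : ∀ (f : A → Bool) {xs ys} → Unique xs → Unique ys →
                 (∀ a → T (f a) → a ∈ xs ⇔ a ∈ ys) → count f xs ≡ count f ys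
  count-unique f {xs} {ys} xs! ys! same =
    ↭-length (∼bag⇒↭ (unique∧set⇒bag (UniqueP.filter⁺ P? xs!) (UniqueP.filter⁺ P? ys!) filtered))
    where
      P? = λ a → Data.Bool._≟_ (f a) true
      transfer : ∀ {a zs zs'} → (T (f a) → a ∈ zs → a ∈ zs') → a ∈ filter P? zs → a ∈ filter P? zs'
      transfer move a∈ with ∈-filter⁻ P? a∈
      ... | a∈zs , fa = ∈-filter⁺ P? (move (from T-≡ fa) a∈zs) fa
      filtered : ∀ {a} → a ∈ filter P? xs ⇔ a ∈ filter P? ys
      filtered {a} = mk⇔ (transfer (to ∘ same a)) (transfer (from ∘ same a))

  data Twice (P : A → Set) : List A → Set where
    here  : ∀ {x xs} → P x → Any P xs → Twice P (x ∷ xs)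
    there : ∀ {x xs} → Twice P xs → Twice P (x ∷ xs)

  Twice-map : ∀ {P Q : A → Set} {xs} → (∀ {x} → P x → Q x) → Twice P xs → Twice Q xs
  Twice-map f (here p ps) = here (f p) (Any.map f ps)
  Twice-map f (there tw)  = there (Twice-map f tw)

  Twice-cong : ∀ {P Q : A → Set} {xs} → (∀ {x} → P x ⇔ Q x) → Twice P xs ⇔ Twice Q xs
  Twice-cong P⇔Q = mk⇔ (Twice-map (to P⇔Q)) (Twice-map (from P⇔Q))

  count>0⇒Any : ∀ (f : A → Bool) xs → 1 ≤ count f xs → Any (T ∘ f) xs
  count>0⇒Any f (x ∷ xs) pos with f x in fx
  ... | true  = here (from T-≡ fx)
  ... | false = there (count>0⇒Any f xs pos)

  Any⇒count>0 : ∀ (f : A → Bool) {xs} → Any (T ∘ f) xs → 1 ≤ count f xs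
  Any⇒count>0 f {x ∷ xs} (here fx) with f x
  ... | true = s≤s z≤n
  Any⇒count>0 f {x ∷ xs} (there any) with f x
  ... | true  = s≤s z≤n
  ... | false = Any⇒count>0 f any

  count≥2⇒Twice : ∀ (f : A → Bool) xs → 2 ≤ count f xs → Twice (T ∘ f) xs
  count≥2⇒Twice f (x ∷ xs) two with f x in fx
  ... | true  = here (from T-≡ fx) (count>0⇒Any f xs (ℕP.≤-pred two))
  ... | false = there (count≥2⇒Twice f xs two)

  Twice⇒count≥2 : ∀ (f : A → Bool) {xs} → Twice (T ∘ f) xs → 2 ≤ count f xs
  Twice⇒count≥2 f {x ∷ xs} (here fx any) with f x
  ... | true = s≤s (Any⇒count>0 f any)
  Twice⇒count≥2 f {x ∷ xs} (there tw) with f x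
  ... | true  = ℕP.m≤n⇒m≤1+n (Twice⇒count≥2 f tw)
  ... | false = Twice⇒count≥2 f tw

  count≥2⇔Twice : ∀ (f : A → Bool) xs → 2 ≤ count f xs ⇔ Twice (T ∘ f) xs
  count≥2⇔Twice f xs = mk⇔ (count≥2⇒Twice f xs) (Twice⇒count≥2 f)

  Twice-pair : ∀ {P : A → Set} {R : A → A → Set} {xs} → AllPairs R xs → Twice P xs →
               ∃ λ x → ∃ λ y → R x y × P x × P y
  Twice-pair (rx ∷ _)  (here px ps) with All.lookupAny rx ps
  ... | rxy , py = _ , _ , rxy , px , py
  Twice-pair (_ ∷ rs) (there tw) = Twice-pair rs tw

open Counting

T-injective : ∀ {a b : Bool} → T a ⇔ T b → a ≡ b
T-injective {a} {b} a⇔b = ⇔→≡ {z = true} (mk⇔ (to T-≡ ∘ to a⇔b ∘ from T-≡)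
                                             (to T-≡ ∘ from a⇔b ∘ from T-≡))

parity : ∀ n → (∃[ j ] n ≡ 2 * j) ⊎ (∃[ j ] n ≡ suc (2 * j))
parity zero = inj₁ (0 , refl)
parity (suc n) with parity n
... | inj₁ (j , refl) = inj₂ (j , refl)
... | inj₂ (j , refl) = inj₁ (suc j , sym (cong suc (ℕP.+-suc j (j + 0))))

module Relabelling (S : ℕ) where

  _≟V_ : (u v : V S) → Dec (u ≡ v)
  _≟V_ = ×P.≡-dec FinP._≟_ FinP._≟_

  vertices-as-product : vertices S ≡ cartesianProduct (allFin S) (allFin S)
  vertices-as-product = go (allFin S)
    where
      go : ∀ xs → concatMap (λ x → map (x ,_) (allFin S)) xs ≡ cartesianProduct xs (allFin S)
      go []       = refl
      go (x ∷ xs) = cong (map (x ,_) (allFin S) ++_) (go xs)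

  vertices-unique : Unique (vertices S)
  vertices-unique rewrite vertices-as-product = UniqueP.cartesianProduct⁺ (UniqueP.allFin⁺ S) (UniqueP.allFin⁺ S)

  vertices-complete : ∀ u → u ∈ vertices S
  vertices-complete (x , y) rewrite vertices-as-product = ∈-cartesianProduct⁺ (∈-allFin x) (∈-allFin y)

  step-diagonal : ∀ (G : Graph S) u → step G u u ≡ G u u
  step-diagonal G (x , y) with x FinP.≟ x | y FinP.≟ y
  ... | yes _  | yes _  = refl
  ... | no x≢x | _      = ⊥-elim (x≢x refl)
  ... | yes _  | no y≢y = ⊥-elim (y≢y refl)

  ==V-sound : ∀ {u v : V S} → u ==V v ≡ true → u ≡ v
  ==V-sound {x , y} {x' , y'} eq with x FinP.≟ x' | y FinP.≟ y' | eq
  ... | yes refl | yes refl | _ = refl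

  step-off-diagonal : ∀ (G : Graph S) {u v} → u ≢ v → step G u v ≡ (2 ≤ᵇ energy G u v)
  step-off-diagonal G {u} {v} u≢v with u ==V v in eq
  ... | true  = ⊥-elim (u≢v (==V-sound eq))
  ... | false with G u v | energy G u v
  ... | true  | _     = refl
  ... | false | zero  = refl
  ... | false | suc _ = refl

  step-cong : ∀ {G H : Graph S} → G ≈G H → step G ≈G step H
  step-cong {G} {H} G≈H u v =
    cong₂ (λ b e → if not (u ==V v) ∧ (b ∨ (1 ≤ᵇ e)) then 2 ≤ᵇ e else b)
          (G≈H u v) (count-cong {xs = vertices S} (All.tabulate λ {w} _ → cong₂ _∧_ (G≈H u w) (G≈H v w)))

  pullback : (V S → V S) → Graph S → Graph S
  pullback σ G u v = G (σ u) (σ v)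

  module _ (σ : V S → V S) (σ⁻¹ : V S → V S)
           (σσ⁻¹ : ∀ u → σ (σ⁻¹ u) ≡ u) (σ⁻¹σ : ∀ u → σ⁻¹ (σ u) ≡ u) where

    σ-injective : ∀ {u v} → σ u ≡ σ v → u ≡ v
    σ-injective {u} {v} e = trans (sym (σ⁻¹σ u)) (trans (cong σ⁻¹ e) (σ⁻¹σ v))

    -- energies, being counts over all vertices, are invariant under relabelling
    energy-pullback : ∀ G u v → energy (pullback σ G) u v ≡ energy G (σ u) (σ v)
    energy-pullback G u v =
      trans (sym (count-map common σ (vertices S)))
            (count-unique common (UniqueP.map⁺ σ-injective vertices-unique) vertices-unique
              (λ w _ → mk⇔ (λ _ → vertices-complete w)
                           (λ _ → subst (_∈ map σ (vertices S)) (σσ⁻¹ w) (∈-map⁺ σ (vertices-complete (σ⁻¹ w))))))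
      where common = λ w → G (σ u) w ∧ G (σ v) w

    step-pullback : ∀ G → step (pullback σ G) ≈G pullback σ (step G)
    step-pullback G u v with u ≟V v
    ... | yes refl = trans (step-diagonal (pullback σ G) u) (sym (step-diagonal G (σ u)))
    ... | no u≢v   = trans (step-off-diagonal (pullback σ G) u≢v)
                     (trans (cong (2 ≤ᵇ_) (energy-pullback G u v))
                            (sym (step-off-diagonal G (u≢v ∘ σ-injective))))

module Conjugacy (S : ℕ) (σ σ⁻¹ : V S → V S)
                 (σσ⁻¹ : ∀ u → σ (σ⁻¹ u) ≡ u) (σ⁻¹σ : ∀ u → σ⁻¹ (σ u) ≡ u)
                 (first-step : ∀ u v → step (torus S) (σ u) (σ v) ≡ torus S u v) where

  open Relabelling S

  σ^ : ℕ → V S → V S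
  σ^ n u = fold u σ n

  process-shift : ∀ t u v → process S (suc t) (σ u) (σ v) ≡ process S t u v
  process-shift zero    = first-step
  process-shift (suc t) u v =
    trans (sym (step-pullback σ σ⁻¹ σσ⁻¹ σ⁻¹σ (process S (suc t)) u v))
          (step-cong (process-shift t) u v)

  process-σ^ : ∀ n u v → process S n (σ^ n u) (σ^ n v) ≡ torus S u v
  process-σ^ zero    u v = refl
  process-σ^ (suc n) u v = trans (process-shift n (σ^ n u) (σ^ n v)) (process-σ^ n u v)

  σ^-onto : ∀ n u → ∃[ w ] σ^ n w ≡ u
  σ^-onto zero    u = u , refl
  σ^-onto (suc n) u with σ^-onto n (σ⁻¹ u)
  ... | w , σ^w≡σ⁻¹u = w , trans (cong σ σ^w≡σ⁻¹u) (σσ⁻¹ u)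

  agree-on-image : ∀ n {G H : Graph S} → (∀ u v → G (σ^ n u) (σ^ n v) ≡ H (σ^ n u) (σ^ n v)) → G ≈G H
  agree-on-image n agree a b with σ^-onto n a | σ^-onto n b
  ... | u , refl | v , refl = agree u v

  Invariant : ℕ → Set
  Invariant p = ∀ u v → torus S (σ^ p u) (σ^ p v) ≡ torus S u v

  rewind : ∀ p t → process S (t + p) ≈G process S t → process S p ≈G process S 0
  rewind p zero    coincide = coincide
  rewind p (suc t) coincide = rewind p t λ u v →
    trans (sym (process-shift (t + p) u v)) (trans (coincide (σ u) (σ v)) (process-shift t u v))

  coincidence⇒Invariant : ∀ p t → process S (t + p) ≈G process S t → Invariant p
  coincidence⇒Invariant p t coincide u v =
    trans (sym (rewind p t coincide (σ^ p u) (σ^ p v))) (process-σ^ p u v)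

  Invariant⇒periodic : ∀ p → Invariant p → EventuallyPeriodicWith (process S) p
  Invariant⇒periodic p invariant = 0 , λ t _ → period t
    where
      period : ∀ t → process S (t + p) ≈G process S t
      period zero    = agree-on-image p λ u v → trans (process-σ^ p u v) (sym (invariant u v))
      period (suc t) = agree-on-image 1 λ u v →
        trans (process-shift (t + p) u v) (trans (period t u v) (sym (process-shift t u v)))

module Congruence (S : ℕ) .{{S≢0 : NonZero S}} where

  infix 4 _≋_

  -- a record rather than a definition, so that x and y can be inferred
  record _≋_ (x y : ℤ) : Set where
    constructor congruent
    field divisible : + S ∣ℤ x - y

  private
    by : ∀ {x y e} → x - y ≡ e → + S ∣ℤ e → x ≋ y
    by x-y≡e S∣e = congruent (subst (+ S ∣ℤ_) (sym x-y≡e) S∣e)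

  ≋-reflexive : ∀ {x y} → x ≡ y → x ≋ y
  ≋-reflexive {x} refl = by (ℤP.+-inverseʳ x) (divides 0ℤ refl)

  ≋-refl : ∀ {x} → x ≋ x
  ≋-refl = ≋-reflexive refl

  ≋-sym : ∀ {x y} → x ≋ y → y ≋ x
  ≋-sym {x} {y} (congruent x≋y) = by (flip-difference x y) (∣m⇒∣-m x≋y)
    where flip-difference : ∀ x y → y - x ≡ - (x - y)
          flip-difference = solve-∀

  ≋-trans : ∀ {x y z} → x ≋ y → y ≋ z → x ≋ z
  ≋-trans {x} {y} {z} (congruent x≋y) (congruent y≋z) = by (telescope x y z) (∣m∣n⇒∣m+n x≋y y≋z)
    where telescope : ∀ x y z → x - z ≡ (x - y) ℤ.+ (y - z)
          telescope = solve-∀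

  ≋-setoid : Setoid _ _
  ≋-setoid = record { Carrier = ℤ ; _≈_ = _≋_
                    ; isEquivalence = record { refl = ≋-refl ; sym = ≋-sym ; trans = ≋-trans } }

  +-cong : ∀ {x y u v} → x ≋ y → u ≋ v → x ℤ.+ u ≋ y ℤ.+ v
  +-cong {x} {y} {u} {v} (congruent x≋y) (congruent u≋v) = by (regroup x y u v) (∣m∣n⇒∣m+n x≋y u≋v)
    where regroup : ∀ x y u v → (x ℤ.+ u) - (y ℤ.+ v) ≡ (x - y) ℤ.+ (u - v)
          regroup = solve-∀

  neg-cong : ∀ {x y} → x ≋ y → - x ≋ - y
  neg-cong {x} {y} (congruent x≋y) = by (regroup x y) (∣m⇒∣-m x≋y)
    where regroup : ∀ x y → - x - - y ≡ - (x - y)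
          regroup = solve-∀

  -‿cong : ∀ {x y u v} → x ≋ y → u ≋ v → x - u ≋ y - v
  -‿cong x≋y u≋v = +-cong x≋y (neg-cong u≋v)

  *-congˡ : ∀ c {x y} → x ≋ y → c ℤ.* x ≋ c ℤ.* y
  *-congˡ c {x} {y} (congruent x≋y) = by (regroup c x y) (∣n⇒∣m*n c x≋y)
    where regroup : ∀ c x y → c ℤ.* x - c ℤ.* y ≡ c ℤ.* (x - y)
          regroup = solve-∀

  *-congʳ : ∀ c {x y} → x ≋ y → x ℤ.* c ≋ y ℤ.* c
  *-congʳ c {x} {y} x≋y = ≋-trans (≋-reflexive (ℤP.*-comm x c)) (≋-trans (*-congˡ c x≋y) (≋-reflexive (ℤP.*-comm c y)))

  S≋0 : + S ≋ 0ℤ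
  S≋0 = by (ℤP.+-identityʳ (+ S)) (divides 1ℤ (sym (ℤP.*-identityˡ (+ S))))

  ≋⇔∣ : ∀ {x k} n → x - k ≡ + n → x ≋ k ⇔ S ∣ n
  ≋⇔∣ n x-k≡n = mk⇔ (λ { (congruent S∣x-k) → ∣⇒∣ᵤ (subst (+ S ∣ℤ_) x-k≡n S∣x-k) })
                    (λ S∣n → congruent (subst (+ S ∣ℤ_) (sym x-k≡n) (∣ᵤ⇒∣ S∣n)))

  ι : Fin S → ℤ
  ι a = + toℕ a

  reduce : ℤ → Fin S
  reduce x = fromℕ< (n%ℕd<d x S)

  ι-reduce : ∀ x → ι (reduce x) ≋ x
  ι-reduce x = by difference (divides (- (x /ℕ S)) refl)
    where
      r = + (x %ℕ S)
      q = x /ℕ S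
      cancel : ∀ r q → r - (r ℤ.+ q) ≡ - q
      cancel = solve-∀
      difference : ι (reduce x) - x ≡ - q ℤ.* + S
      difference = begin
        ι (reduce x) - x           ≡⟨ cong₂ _-_ (cong +_ (FinP.toℕ-fromℕ< _)) (a≡a%ℕn+[a/ℕn]*n x S) ⟩
        r - (r ℤ.+ q ℤ.* + S)       ≡⟨ cancel r (q ℤ.* + S) ⟩
        - (q ℤ.* + S)               ≡⟨ ℤP.neg-distribˡ-* q (+ S) ⟩
        - q ℤ.* + S                 ∎
        where open ≡-Reasoning

  multiple-below : ∀ {n} → S ∣ n → n < S → n ≡ 0
  multiple-below {zero}  _   _   = refl
  multiple-below {suc n} S∣n n<S = ⊥-elim (ℕP.<⇒≱ n<S (∣⇒≤ S∣n))

  residue-unique : ∀ {m n} → m < S → n < S → + m ≋ + n → m ≡ n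
  residue-unique {m} {n} m<S n<S (congruent S∣m-n) = ℤP.+-injective (ℤP.i-j≡0⇒i≡j _ _ difference≡0)
    where
      S∣⊖ : + S ∣ℤ m ℤ.⊖ n
      S∣⊖ = subst (+ S ∣ℤ_) (ℤP.m-n≡m⊖n m n) S∣m-n
      small : ℤ.∣ m ℤ.⊖ n ∣ < S
      small = ℕP.≤-<-trans (ℤP.∣m⊝n∣≤m⊔n m n) (ℕP.⊔-lub m<S n<S)
      difference≡0 : + m - + n ≡ 0ℤ
      difference≡0 = trans (ℤP.m-n≡m⊖n m n) (ℤP.∣i∣≡0⇒i≡0 (multiple-below (∣⇒∣ᵤ S∣⊖) small))

  ι-injective : ∀ {a b} → ι a ≋ ι b → a ≡ b
  ι-injective {a} {b} = FinP.toℕ-injective ∘ residue-unique (FinP.toℕ<n a) (FinP.toℕ<n b)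

  Pt : Set
  Pt = ℤ × ℤ

  infix  4 _≋²_
  infixl 6 _+²_ _-²_
  infixr 7 _·_

  _≋²_ : Pt → Pt → Set
  _≋²_ = Pointwise _≋_ _≋_

  ≋²-setoid : Setoid _ _
  ≋²-setoid = ×-setoid ≋-setoid ≋-setoid

  _+²_ _-²_ : Pt → Pt → Pt
  (p , q) +² (p' , q') = p ℤ.+ p' , q ℤ.+ q'
  (p , q) -² (p' , q') = p - p' , q - q'

  -²_ : Pt → Pt
  -² (p , q) = - p , - q

  _·_ : ℤ → Pt → Pt
  k · (p , q) = k ℤ.* p , k ℤ.* q

  -²-cong : ∀ {a b c d} → a ≋² b → c ≋² d → a -² c ≋² b -² d
  -²-cong (p , q) (p' , q') = -‿cong p p' , -‿cong q q'

  ·-cong : ∀ k {a b} → a ≋² b → k · a ≋² k · b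
  ·-cong k (p , q) = *-congˡ k p , *-congˡ k q

  ≋²-refl : ∀ {d} → d ≋² d
  ≋²-refl = Setoid.refl ≋²-setoid

  ≋²-sym : ∀ {d d'} → d ≋² d' → d' ≋² d
  ≋²-sym = Setoid.sym ≋²-setoid

  ≋²-trans : ∀ {d d' d''} → d ≋² d' → d' ≋² d'' → d ≋² d''
  ≋²-trans = Setoid.trans ≋²-setoid

  ≋²-reflexive : ∀ {d d'} → d ≡ d' → d ≋² d'
  ≋²-reflexive = Setoid.reflexive ≋²-setoid

  ·-assoc : ∀ k l d → k · (l · d) ≡ (k ℤ.* l) · d
  ·-assoc k l (p , q) = cong₂ _,_ (sym (ℤP.*-assoc k l p)) (sym (ℤP.*-assoc k l q))

  ≋-shift : ∀ x y {k} → x ≋ y ℤ.+ k ⇔ x - y ≋ k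
  ≋-shift x y {k} = mk⇔
    (λ x≋y+k → ≋-trans (-‿cong x≋y+k ≋-refl) (≋-reflexive (cancel y k)))
    (λ x-y≋k → ≋-trans (≋-reflexive (restore x y)) (+-cong (≋-refl {y}) x-y≋k))
    where
      cancel : ∀ y k → (y ℤ.+ k) - y ≡ k
      cancel = solve-∀
      restore : ∀ x y → x ≡ y ℤ.+ (x - y)
      restore = solve-∀

  ≋-swap : ∀ x y {k} → x - y ≋ k → y - x ≋ - k
  ≋-swap x y x-y≋k = ≋-trans (≋-reflexive (flip-difference x y)) (neg-cong x-y≋k)
    where flip-difference : ∀ x y → y - x ≡ - (x - y)
          flip-difference = solve-∀

  difference≋0 : ∀ {x y} → x ≋ y → x - y ≋ 0ℤ
  difference≋0 {x} {y} x≋y = ≋-trans (-‿cong x≋y (≋-refl {y})) (≋-reflexive (ℤP.+-inverseʳ y))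

  cancel-neg : ∀ {x} → - x ≋ 0ℤ → x ≋ 0ℤ
  cancel-neg {x} -x≋0 = ≋-trans (≋-reflexive (sym (ℤP.neg-involutive x))) (neg-cong -x≋0)

  ≋²-shift : ∀ x y {e} → x -² y ≋² e → x ≋² y +² e
  ≋²-shift (p , q) (p' , q') (dp , dq) = from (≋-shift p p') dp , from (≋-shift q q') dq

  +²-cancelˡ : ∀ z {c c'} → z +² c ≋² z +² c' → c ≋² c'
  +²-cancelˡ (z₁ , z₂) (p , q) = cancel {z₁} p , cancel {z₂} q
    where
      drop : ∀ z u → (z ℤ.+ u) - z ≡ u
      drop = solve-∀
      cancel : ∀ {z u u'} → z ℤ.+ u ≋ z ℤ.+ u' → u ≋ u'
      cancel {z} {u} {u'} z+u≋z+u' =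
        ≋-trans (≋-reflexive (sym (drop z u))) (≋-trans (-‿cong z+u≋z+u' (≋-refl {z})) (≋-reflexive (drop z u')))

  ≋²-solve : ∀ c x {e} → c -² x ≋² e → x ≋² c -² e
  ≋²-solve (c₁ , c₂) (x₁ , x₂) (p , q) = solve₁ {c₁} p , solve₁ {c₂} q
    where
      isolate : ∀ c x → x ≡ c - (c - x)
      isolate = solve-∀
      solve₁ : ∀ {c x e} → c - x ≋ e → x ≋ c - e
      solve₁ {c} {x} c-x≋e = ≋-trans (≋-reflexive (isolate c x)) (-‿cong (≋-refl {c}) c-x≋e)

  coords : V S → Pt
  coords (x , y) = ι x , ι y

  point : Pt → V S
  point (p , q) = reduce p , reduce q

  coords-point : ∀ d → coords (point d) ≋² d
  coords-point (p , q) = ι-reduce p , ι-reduce q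

  coords-injective : ∀ {u v} → coords u ≋² coords v → u ≡ v
  coords-injective {_ , _} {_ , _} (p , q) = cong₂ _,_ (ι-injective p) (ι-injective q)

module TorusCoordinates (S : ℕ) .{{S≢0 : NonZero S}} where

  open Congruence S

  -- the unit vectors, in the order in which `torus` lists its cases
  units : List Pt
  units = (0ℤ , 1ℤ) ∷ (0ℤ , -1ℤ) ∷ (1ℤ , 0ℤ) ∷ (-1ℤ , 0ℤ) ∷ []

  IsUnit : Pt → Set
  IsUnit d = Any (d ≋²_) units

  IsUnit-resp : ∀ {d d'} → d ≋² d' → IsUnit d → IsUnit d'
  IsUnit-resp d≋d' = Any.map (Setoid.trans ≋²-setoid (Setoid.sym ≋²-setoid d≋d'))

  IsUnit-neg : ∀ {d} → IsUnit d → IsUnit (-² d)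
  IsUnit-neg {_ , _} (here (p , q))                       = there (here (neg-cong p , neg-cong q))
  IsUnit-neg {_ , _} (there (here (p , q)))               = here (neg-cong p , neg-cong q)
  IsUnit-neg {_ , _} (there (there (here (p , q))))       = there (there (there (here (neg-cong p , neg-cong q))))
  IsUnit-neg {_ , _} (there (there (there (here (p , q))))) = there (there (here (neg-cong p , neg-cong q)))

  pos-suc : ∀ n → + suc n ≡ + n ℤ.+ 1ℤ
  pos-suc n = trans (cong +_ (ℕP.+-comm 1 n)) (ℤP.pos-+ n 1)

  cycSucc-sound : ∀ a b → T (cycSucc a b) → ι b ≋ ι a ℤ.+ 1ℤ
  cycSucc-sound a b succ with to T-∨ succ
  ... | inj₁ b≡a+1 = ≋-reflexive (trans (cong +_ (ℕP.≡ᵇ⇒≡ _ _ b≡a+1)) (pos-suc (toℕ a)))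
  ... | inj₂ wrap with to T-∧ wrap
  ...   | a≡S-1 , b≡0 = ≋-trans (≋-reflexive (cong +_ (ℕP.≡ᵇ⇒≡ _ _ b≡0))) (≋-trans (≋-sym S≋0) (≋-reflexive S≡a+1))
    where
      S≡a+1 : + S ≡ ι a ℤ.+ 1ℤ
      S≡a+1 = trans (cong +_ (sym (trans (cong suc (ℕP.≡ᵇ⇒≡ _ _ a≡S-1)) (ℕP.m+[n∸m]≡n (>-nonZero⁻¹ S)))))
                    (pos-suc (toℕ a))

  cycSucc-complete : ∀ a b → ι b ≋ ι a ℤ.+ 1ℤ → T (cycSucc a b)
  cycSucc-complete a b b≋a+1 with suc (toℕ a) ℕP.<? S
  ... | yes a+1<S = from T-∨ (inj₁ (ℕP.≡⇒≡ᵇ _ _ (residue-unique (FinP.toℕ<n b) a+1<S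
                      (≋-trans b≋a+1 (≋-reflexive (sym (pos-suc (toℕ a))))))))
  ... | no a+1≮S = from T-∨ (inj₂ (from T-∧ (ℕP.≡⇒≡ᵇ _ _ (cong (_∸ 1) a+1≡S) , ℕP.≡⇒≡ᵇ _ _ b≡0)))
    where
      a+1≡S : suc (toℕ a) ≡ S
      a+1≡S = ℕP.≤-antisym (FinP.toℕ<n a) (ℕP.≮⇒≥ a+1≮S)
      b≡0 : toℕ b ≡ 0
      b≡0 = residue-unique (FinP.toℕ<n b) (>-nonZero⁻¹ S)
              (≋-trans b≋a+1 (≋-trans (≋-reflexive (trans (sym (pos-suc (toℕ a))) (cong +_ a+1≡S))) S≋0))

  cycAdj-spec : ∀ a b → T (cycAdj a b) ⇔ (ι b - ι a ≋ 1ℤ ⊎ ι b - ι a ≋ -1ℤ)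
  cycAdj-spec a b = mk⇔ sound complete
    where
      sound : T (cycAdj a b) → ι b - ι a ≋ 1ℤ ⊎ ι b - ι a ≋ -1ℤ
      sound adj with to (T-∨ {cycSucc a b}) adj
      ... | inj₁ up   = inj₁ (to (≋-shift (ι b) (ι a)) (cycSucc-sound a b up))
      ... | inj₂ down = inj₂ (≋-swap (ι a) (ι b) (to (≋-shift (ι a) (ι b)) (cycSucc-sound b a down)))
      complete : ι b - ι a ≋ 1ℤ ⊎ ι b - ι a ≋ -1ℤ → T (cycAdj a b)
      complete (inj₁ up)   = from (T-∨ {cycSucc a b}) (inj₁ (cycSucc-complete a b (from (≋-shift (ι b) (ι a)) up)))
      complete (inj₂ down) = from (T-∨ {cycSucc a b}) (inj₂ (cycSucc-complete b a
                               (from (≋-shift (ι a) (ι b)) (≋-swap (ι b) (ι a) down))))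

  same-spec : ∀ a b → T ⌊ a FinP.≟ b ⌋ ⇔ ι b - ι a ≋ 0ℤ
  same-spec a b = mk⇔
    (λ a≡b → ≋-reflexive (trans (cong (λ c → ι c - ι a) (sym (toWitness a≡b))) (ℤP.+-inverseʳ (ι a))))
    (λ b-a≋0 → fromWitness (sym (ι-injective (≋-trans (from (≋-shift (ι b) (ι a)) b-a≋0) (≋-reflexive (ℤP.+-identityʳ (ι a)))))))

  torus-spec : ∀ u v → T (torus S u v) ⇔ IsUnit (coords v -² coords u)
  torus-spec (x , y) (x' , y') = mk⇔ sound complete
    where
      sound : T (torus S (x , y) (x' , y')) → IsUnit (ι x' - ι x , ι y' - ι y)
      sound adj with to T-∨ adj
      ... | inj₁ vertical with to T-∧ vertical
      ...   | same , step with to (cycAdj-spec y y') step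
      ...     | inj₁ up   = here (to (same-spec x x') same , up)
      ...     | inj₂ down = there (here (to (same-spec x x') same , down))
      sound adj | inj₂ horizontal with to T-∧ horizontal
      ...   | same , step with to (cycAdj-spec x x') step
      ...     | inj₁ up   = there (there (here (up , to (same-spec y y') same)))
      ...     | inj₂ down = there (there (there (here (down , to (same-spec y y') same))))
      vertical : ι x' - ι x ≋ 0ℤ → ι y' - ι y ≋ 1ℤ ⊎ ι y' - ι y ≋ -1ℤ → T (torus S (x , y) (x' , y'))
      vertical same step = from T-∨ (inj₁ (from T-∧ (from (same-spec x x') same , from (cycAdj-spec y y') step)))
      horizontal : ι y' - ι y ≋ 0ℤ → ι x' - ι x ≋ 1ℤ ⊎ ι x' - ι x ≋ -1ℤ → T (torus S (x , y) (x' , y'))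
      horizontal same step = from T-∨ (inj₂ (from T-∧ (from (same-spec y y') same , from (cycAdj-spec x x') step)))
      complete : IsUnit (ι x' - ι x , ι y' - ι y) → T (torus S (x , y) (x' , y'))
      complete (here (same , up))                        = vertical same (inj₁ up)
      complete (there (here (same , down)))              = vertical same (inj₂ down)
      complete (there (there (here (up , same))))        = horizontal same (inj₁ up)
      complete (there (there (there (here (down , same))))) = horizontal same (inj₂ down)

-- The torus of odd side S ≥ 3; h = (S + 1)/2 is the inverse of 2 modulo S.
module OddTorus (S : ℕ) (S≥3 : 3 ≤ S) (h : ℕ) (2h≡S+1 : 2 * h ≡ S + 1) where

  instance
    S-nonZero : NonZero S
    S-nonZero = >-nonZero (ℕP.<-≤-trans (s≤s z≤n) S≥3)

  open Congruence S
  open TorusCoordinates S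
  open Relabelling S

  halve : ∀ x → + h ℤ.* (+ 2 ℤ.* x) ≋ x
  halve x = ≋-trans (≋-reflexive expand) (≋-trans (+-cong (*-congˡ x S≋0) (≋-refl {x})) (≋-reflexive drop-multiple))
    where
      drop-multiple : x ℤ.* 0ℤ ℤ.+ x ≡ x
      drop-multiple = trans (cong (ℤ._+ x) (ℤP.*-zeroʳ x)) (ℤP.+-identityˡ x)
      2h≡S+1ℤ : + 2 ℤ.* + h ≡ + S ℤ.+ 1ℤ
      2h≡S+1ℤ = trans (sym (ℤP.pos-* 2 h)) (trans (cong +_ 2h≡S+1) (ℤP.pos-+ S 1))
      regroup : ∀ h x → h ℤ.* (+ 2 ℤ.* x) ≡ (+ 2 ℤ.* h) ℤ.* x
      regroup = solve-∀
      distribute : ∀ s x → (s ℤ.+ 1ℤ) ℤ.* x ≡ x ℤ.* s ℤ.+ x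
      distribute = solve-∀
      expand : + h ℤ.* (+ 2 ℤ.* x) ≡ x ℤ.* + S ℤ.+ x
      expand = trans (regroup (+ h) x) (trans (cong (ℤ._* x) 2h≡S+1ℤ) (distribute (+ S) x))

  -- since S ≥ 3, 1 is not divisible by S; since h inverts 2, neither are ±2 and ±4
  1≉0 : ¬ 1ℤ ≋ 0ℤ
  1≉0 (congruent S∣1) = case-3≤1 (subst (3 ≤_) (∣1⇒≡1 (∣⇒∣ᵤ S∣1)) S≥3)
    where case-3≤1 : ¬ 3 ≤ 1
          case-3≤1 (s≤s ())

  cancel-2 : ∀ {x} → + 2 ℤ.* x ≋ 0ℤ → x ≋ 0ℤ
  cancel-2 {x} 2x≋0 = ≋-trans (≋-sym (halve x)) (≋-trans (*-congˡ (+ h) 2x≋0) (≋-reflexive (ℤP.*-zeroʳ (+ h))))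

  -- the differences of coordinates of small vectors that we need to tell apart
  smallNonzero : List ℤ
  smallNonzero = 1ℤ ∷ -1ℤ ∷ + 2 ∷ - + 2 ∷ + 4 ∷ - + 4 ∷ []

  small-nonzero : All (λ k → ¬ k ≋ 0ℤ) smallNonzero
  small-nonzero = 1≉0 ∷ 1≉0 ∘ cancel-neg ∷ 2≉0 ∷ 2≉0 ∘ cancel-neg ∷ 4≉0 ∷ 4≉0 ∘ cancel-neg ∷ []
    where
      2≉0 = 1≉0 ∘ cancel-2
      4≉0 = 2≉0 ∘ cancel-2

  Apart : Pt → Pt → Set
  Apart (p , q) (p' , q') = p - p' ∈ smallNonzero ⊎ q - q' ∈ smallNonzero

  apart? : ∀ d d' → Dec (Apart d d')
  apart? (p , q) (p' , q') = (p - p' ∈? smallNonzero) ⊎-dec (q - q' ∈? smallNonzero)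
    where open import Data.List.Membership.DecPropositional ℤ._≟_ using (_∈?_)

  Apart⇒≉ : ∀ {d d'} → Apart d d' → ¬ d ≋² d'
  Apart⇒≉ (inj₁ p-p'∈) (p≋p' , _) = All.lookup small-nonzero p-p'∈ (difference≋0 p≋p')
  Apart⇒≉ (inj₂ q-q'∈) (_ , q≋q') = All.lookup small-nonzero q-q'∈ (difference≋0 q≋q')

  units-apart : AllPairs (λ c c' → ¬ c ≋² c') units
  units-apart = AllPairs.map Apart⇒≉ (toWitness {a? = allPairs? apart? units} tt)

  ¬IsUnit-diagonal : ∀ {p q} → p ≋ q → ¬ IsUnit (p , q)
  ¬IsUnit-diagonal p≋q (here (p≋0 , q≋1)) = 1≉0 (≋-trans (≋-sym q≋1) (≋-trans (≋-sym p≋q) p≋0))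
  ¬IsUnit-diagonal p≋q (there (here (p≋0 , q≋-1))) =
    1≉0 (cancel-neg (≋-trans (≋-sym q≋-1) (≋-trans (≋-sym p≋q) p≋0)))
  ¬IsUnit-diagonal p≋q (there (there (here (p≋1 , q≋0)))) = 1≉0 (≋-trans (≋-sym p≋1) (≋-trans p≋q q≋0))
  ¬IsUnit-diagonal p≋q (there (there (there (here (p≋-1 , q≋0))))) =
    1≉0 (cancel-neg (≋-trans (≋-sym p≋-1) (≋-trans p≋q q≋0)))

  -- The linear map rot(p, q) = (p + q, p - q); since 2 is invertible modulo S
  -- it is a bijection of ℤ² modulo S, with inverse h · rot.
  rot : Pt → Pt
  rot (p , q) = p ℤ.+ q , p - q

  rot-cong : ∀ {a b} → a ≋² b → rot a ≋² rot b
  rot-cong (p , q) = +-cong p q , -‿cong p q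

  rot-rot : ∀ d → rot (rot d) ≡ + 2 · d
  rot-rot (p , q) = cong₂ _,_ (first p q) (second p q)
    where
      first : ∀ p q → (p ℤ.+ q) ℤ.+ (p - q) ≡ + 2 ℤ.* p
      first = solve-∀
      second : ∀ p q → (p ℤ.+ q) - (p - q) ≡ + 2 ℤ.* q
      second = solve-∀

  rot-· : ∀ k d → rot (k · d) ≡ k · rot d
  rot-· k (p , q) = cong₂ _,_ (sym (ℤP.*-distribˡ-+ k p q)) (distrib k p q)
    where distrib : ∀ k p q → k ℤ.* p - k ℤ.* q ≡ k ℤ.* (p - q)
          distrib = solve-∀

  rot-difference : ∀ a b → rot a -² rot b ≡ rot (a -² b)
  rot-difference (p , q) (p' , q') = cong₂ _,_ (first p q p' q') (second p q p' q')
    where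
      first : ∀ p q p' q' → (p ℤ.+ q) - (p' ℤ.+ q') ≡ (p - p') ℤ.+ (q - q')
      first = solve-∀
      second : ∀ p q p' q' → (p - q) - (p' - q') ≡ (p - p') - (q - q')
      second = solve-∀

  halve-rot-rot : ∀ d → + h · rot (rot d) ≋² d
  halve-rot-rot d@(p , q) = subst (λ e → + h · e ≋² d) (sym (rot-rot d)) (halve p , halve q)

  rot-injective : ∀ {a b} → rot a ≋² rot b → a ≋² b
  rot-injective {a} {b} ra≋rb =
    ≋²-trans (≋²-sym (halve-rot-rot a)) (≋²-trans (·-cong (+ h) (rot-cong ra≋rb)) (halve-rot-rot b))

  φ ψ : V S → V S
  φ u = point (rot (coords u))
  ψ u = point (+ h · rot (coords u))

  coords-φ : ∀ u → coords (φ u) ≋² rot (coords u)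
  coords-φ u = coords-point (rot (coords u))

  φψ : ∀ u → φ (ψ u) ≡ u
  φψ u = coords-injective (begin
    coords (φ (ψ u))              ≈⟨ coords-φ (ψ u) ⟩
    rot (coords (ψ u))            ≈⟨ rot-cong (coords-point (+ h · rot (coords u))) ⟩
    rot (+ h · rot (coords u))    ≡⟨ rot-· (+ h) (rot (coords u)) ⟩
    + h · rot (rot (coords u))    ≈⟨ halve-rot-rot (coords u) ⟩
    coords u                      ∎)
    where open import Relation.Binary.Reasoning.Setoid ≋²-setoid

  ψφ : ∀ u → ψ (φ u) ≡ u
  ψφ u = coords-injective (begin
    coords (ψ (φ u))              ≈⟨ coords-point (+ h · rot (coords (φ u))) ⟩
    + h · rot (coords (φ u))      ≈⟨ ·-cong (+ h) (rot-cong (coords-φ u)) ⟩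
    + h · rot (rot (coords u))    ≈⟨ halve-rot-rot (coords u) ⟩
    coords u                      ∎)
    where open import Relation.Binary.Reasoning.Setoid ≋²-setoid

  φ-injective : ∀ {u v} → φ u ≡ φ v → u ≡ v
  φ-injective {u} {v} φu≡φv = trans (sym (ψφ u)) (trans (cong ψ φu≡φv) (ψφ v))

  torus-irreflexive : ∀ u → torus S u u ≡ false
  torus-irreflexive u@(x , y) = T-injective (mk⇔ (⊥-elim ∘ ¬IsUnit-diagonal x-x≋y-y ∘ to (torus-spec u u)) λ ())
    where
      x-x≋y-y : ι x - ι x ≋ ι y - ι y
      x-x≋y-y = ≋-reflexive (trans (ℤP.+-inverseʳ (ι x)) (sym (ℤP.+-inverseʳ (ι y))))

  translate : V S → Pt → V S
  translate a c = point (coords a +² c)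

  translate-injective : ∀ a {c c'} → translate a c ≡ translate a c' → c ≋² c'
  translate-injective a {c} {c'} eq = +²-cancelˡ (coords a) (begin
    coords a +² c             ≈⟨ ≋²-sym (coords-point (coords a +² c)) ⟩
    coords (translate a c)    ≡⟨ cong coords eq ⟩
    coords (translate a c')   ≈⟨ coords-point (coords a +² c') ⟩
    coords a +² c'            ∎)
    where open import Relation.Binary.Reasoning.Setoid ≋²-setoid

  translate-from : ∀ a b c → coords (translate a c) -² coords b ≋² c -² (coords b -² coords a)
  translate-from a@(x , y) b@(x' , y') c@(c₁ , c₂) =
    ≋²-trans (-²-cong (coords-point (coords a +² c)) (≋²-refl {coords b}))
             (≋-reflexive (regroup (ι x) c₁ (ι x')) , ≋-reflexive (regroup (ι y) c₂ (ι y')))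
    where
      regroup : ∀ a c b → (a ℤ.+ c) - b ≡ c - (b - a)
      regroup = solve-∀

  adjacent-translate : ∀ a {c} → c ∈ units → T (torus S a (translate a c))
  adjacent-translate a {c} c∈ = from (torus-spec a (translate a c))
    (IsUnit-resp (≋²-sym (translate-from-self c)) (Any.map (λ { refl → ≋²-refl }) c∈))
    where
      translate-from-self : ∀ c → coords (translate a c) -² coords a ≋² c
      translate-from-self c@(c₁ , c₂) = ≋²-trans (translate-from a a c)
        (≋-reflexive (vanish c₁ (ι (proj₁ a))) , ≋-reflexive (vanish c₂ (ι (proj₂ a))))
        where vanish : ∀ c a → c - (a - a) ≡ c
              vanish = solve-∀

  neighbours : V S → List (V S)
  neighbours a = map (translate a) units

  neighbours-unique : ∀ a → Unique (neighbours a)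
  neighbours-unique a = AllPairsP.map⁺ (AllPairs.map (λ c≉c' → c≉c' ∘ translate-injective a) units-apart)

  torus-neighbours : ∀ a w → T (torus S a w) → w ∈ neighbours a
  torus-neighbours a w adjacent = AnyP.map⁺ (Any.map is-translate (to (torus-spec a w) adjacent))
    where
      is-translate : ∀ {c} → coords w -² coords a ≋² c → w ≡ translate a c
      is-translate {c} w-a≋c =
        coords-injective (≋²-trans (≋²-shift (coords w) (coords a) w-a≋c) (≋²-sym (coords-point (coords a +² c))))

  energy-torus : ∀ a b → energy (torus S) a b ≡ count (λ c → torus S b (translate a c)) units
  energy-torus a b = begin
    count common (vertices S)                         ≡⟨ count-unique common vertices-unique (neighbours-unique a) same-common ⟩
    count common (neighbours a)                       ≡⟨ count-map common (translate a) units ⟩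
    count (common ∘ translate a) units                ≡⟨ count-cong (All.tabulate λ {c} c∈ → cong (_∧ torus S b (translate a c)) (to T-≡ (adjacent-translate a c∈))) ⟩
    count (λ c → torus S b (translate a c)) units     ∎
    where
      open ≡-Reasoning
      common = λ w → torus S a w ∧ torus S b w
      same-common : ∀ w → T (common w) → w ∈ vertices S ⇔ w ∈ neighbours a
      same-common w both = mk⇔ (λ _ → torus-neighbours a w (proj₁ (to T-∧ both))) (λ _ → vertices-complete w)

  neighbour-spec : ∀ a b c → T (torus S b (translate a c)) ⇔ IsUnit (c -² (coords b -² coords a))
  neighbour-spec a b c = mk⇔ (IsUnit-resp (translate-from a b c) ∘ to (torus-spec b (translate a c)))
                             (from (torus-spec b (translate a c)) ∘ IsUnit-resp (≋²-sym (translate-from a b c)))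

  -- If rot E ≡ c - e for unit vectors c and e, then c - e is zero, a rotated
  -- unit vector, or one of (±2, 0), (0, ±2); in the last case no other pair
  -- c' - e' with c' ≠ c is congruent to it.  `Settled` records this trichotomy
  -- and is checked by computation for all c ≠ c', e, e'.
  Settled : Pt → Pt → Set
  Settled d d' = Apart d d' ⊎ (d ∈ map rot units ⊎ d ≡ (0ℤ , 0ℤ))

  settled? : ∀ d d' → Dec (Settled d d')
  settled? d d' = apart? d d' ⊎-dec (d ∈? map rot units) ⊎-dec (d ≟² (0ℤ , 0ℤ))
    where
      _≟²_ = ×P.≡-dec ℤ._≟_ ℤ._≟_
      open import Data.List.Membership.DecPropositional _≟²_ using (_∈?_)

  Resolved : Pt → Pt → Set
  Resolved c c' = All (λ e → All (λ e' → Settled (c -² e) (c' -² e')) units) units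

  units-resolved : AllPairs Resolved units
  units-resolved = toWitness {a? = allPairs? resolved? units} tt
    where resolved? = λ c c' → all? (λ e → all? (λ e' → settled? (c -² e) (c' -² e')) units) units

  collision : ∀ E → Twice (λ c → IsUnit (c -² rot E)) units → IsUnit E ⊎ E ≋² (0ℤ , 0ℤ)
  collision E twice with Twice-pair units-resolved twice
  ... | c , c' , resolved , c-unit , c'-unit with All.lookupAny resolved c-unit
  ... | row , c-rotE≋e with All.lookupAny row c'-unit
  ... | settled , c'-rotE≋e' with settled
  ...   | inj₁ apart = ⊥-elim (Apart⇒≉ apart (≋²-trans (≋²-sym rotE≋d) rotE≋d'))
    where rotE≋d  = ≋²-solve c  (rot E) c-rotE≋e
          rotE≋d' = ≋²-solve c' (rot E) c'-rotE≋e'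
  ...   | inj₂ (inj₁ d∈rot-units) with ∈-map⁻ rot d∈rot-units
  ...     | e₀ , e₀∈ , d≡rot-e₀ = inj₁ (Any.map (λ { refl → E≋e₀ }) e₀∈)
    where E≋e₀ = rot-injective (subst (rot E ≋²_) d≡rot-e₀ (≋²-solve c (rot E) c-rotE≋e))
  collision E twice | c , c' , _ , _ , _ | _ , c-rotE≋e | _ | inj₂ (inj₂ d≡0) =
    inj₂ (rot-injective (subst (rot E ≋²_) d≡0 (≋²-solve c (rot E) c-rotE≋e)))

  shifted : ∀ {E} e → E ≋² e → ∀ c → IsUnit (c -² rot e) → IsUnit (c -² rot E)
  shifted e E≋e c = IsUnit-resp (-²-cong (≋²-refl {c}) (rot-cong (≋²-sym E≋e)))

  -- conversely, for a unit vector E there are two such c; e.g. for E = (1, 0),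
  -- rot E = (1, 1) and c = (0, 1), (1, 0) give the units (-1, 0), (0, -1)
  unit⇒Twice : ∀ {E} → IsUnit E → Twice (λ c → IsUnit (c -² rot E)) units
  unit⇒Twice {E} (here E≋n) =
    there (here (shifted (0ℤ , 1ℤ) E≋n (0ℤ , -1ℤ) (there (there (there (here ≋²-refl)))))
                (here (shifted (0ℤ , 1ℤ) E≋n (1ℤ , 0ℤ) (here ≋²-refl))))
  unit⇒Twice {E} (there (here E≋s)) =
    here (shifted (0ℤ , -1ℤ) E≋s (0ℤ , 1ℤ) (there (there (here ≋²-refl))))
         (there (there (here (shifted (0ℤ , -1ℤ) E≋s (-1ℤ , 0ℤ) (there (here ≋²-refl))))))
  unit⇒Twice {E} (there (there (here E≋e))) =
    here (shifted (1ℤ , 0ℤ) E≋e (0ℤ , 1ℤ) (there (there (there (here ≋²-refl)))))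
         (there (here (shifted (1ℤ , 0ℤ) E≋e (1ℤ , 0ℤ) (there (here ≋²-refl)))))
  unit⇒Twice {E} (there (there (there (here E≋w)))) =
    there (here (shifted (-1ℤ , 0ℤ) E≋w (0ℤ , -1ℤ) (there (there (here ≋²-refl))))
                (there (here (shifted (-1ℤ , 0ℤ) E≋w (-1ℤ , 0ℤ) (here ≋²-refl)))))

  Twice⇔IsUnit : ∀ E → ¬ E ≋² (0ℤ , 0ℤ) → Twice (λ c → IsUnit (c -² rot E)) units ⇔ IsUnit E
  Twice⇔IsUnit E E≉0 = mk⇔ (λ twice → [ (λ unit → unit) , (⊥-elim ∘ E≉0) ]′ (collision E twice)) unit⇒Twice

  first-step : ∀ u v → step (torus S) (φ u) (φ v) ≡ torus S u v
  first-step u v with u ≟V v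
  ... | yes refl = trans (step-diagonal (torus S) (φ u)) (trans (torus-irreflexive (φ u)) (sym (torus-irreflexive u)))
  ... | no u≢v   = trans (step-off-diagonal (torus S) (u≢v ∘ φ-injective)) (T-injective (begin
    T (2 ≤ᵇ energy (torus S) a b)                       ≈⟨ mk⇔ (ℕP.≤ᵇ⇒≤ 2 _) (ℕP.≤⇒≤ᵇ) ⟩
    2 ≤ energy (torus S) a b                             ≡⟨ cong (2 ≤_) (energy-torus a b) ⟩
    2 ≤ count (λ c → torus S b (translate a c)) units    ≈⟨ count≥2⇔Twice (λ c → torus S b (translate a c)) units ⟩
    Twice (λ c → T (torus S b (translate a c))) units    ≈⟨ Twice-cong (λ {c} → neighbour-spec a b c) ⟩
    Twice (λ c → IsUnit (c -² D)) units                  ≈⟨ Twice-cong (λ {c} → mk⇔ (IsUnit-resp (D≋rotE c)) (IsUnit-resp (≋²-sym (D≋rotE c)))) ⟩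
    Twice (λ c → IsUnit (c -² rot E)) units              ≈⟨ Twice⇔IsUnit E E≉0 ⟩
    IsUnit E                                             ≈⟨ Setoid.sym (⇔-setoid _) (torus-spec u v) ⟩
    T (torus S u v)                                      ∎))
    where
      open import Relation.Binary.Reasoning.Setoid (⇔-setoid 0ℓ)
      a = φ u
      b = φ v
      D = coords b -² coords a
      E = coords v -² coords u
      D≋rotE : ∀ c → c -² D ≋² c -² rot E
      D≋rotE c = -²-cong (≋²-refl {c}) (≋²-trans (-²-cong (coords-φ v) (coords-φ u))
                                                  (≋²-reflexive (rot-difference (coords v) (coords u))))
      E≉0 : ¬ E ≋² (0ℤ , 0ℤ)
      E≉0 E≋0 = u≢v (sym (coords-injective (≋²-trans (≋²-shift (coords v) (coords u) E≋0)
                                                     (≋-reflexive (ℤP.+-identityʳ _) , ≋-reflexive (ℤP.+-identityʳ _)))))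

  open Conjugacy S φ ψ φψ ψφ first-step

  fold-rot-cong : ∀ n {a b} → a ≋² b → fold a rot n ≋² fold b rot n
  fold-rot-cong zero    a≋b = a≋b
  fold-rot-cong (suc n) a≋b = rot-cong (fold-rot-cong n a≋b)

  fold-rot-difference : ∀ n a b → fold a rot n -² fold b rot n ≡ fold (a -² b) rot n
  fold-rot-difference zero    a b = refl
  fold-rot-difference (suc n) a b = trans (rot-difference (fold a rot n) (fold b rot n)) (cong rot (fold-rot-difference n a b))

  coords-σ^ : ∀ n u → coords (σ^ n u) ≋² fold (coords u) rot n
  coords-σ^ zero    u = ≋²-refl
  coords-σ^ (suc n) u = ≋²-trans (coords-φ (σ^ n u)) (rot-cong (coords-σ^ n u))

  difference-σ^ : ∀ n u v → coords (σ^ n v) -² coords (σ^ n u) ≋² fold (coords v -² coords u) rot n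
  difference-σ^ n u v = subst (coords (σ^ n v) -² coords (σ^ n u) ≋²_) (fold-rot-difference n (coords v) (coords u))
                          (-²-cong (coords-σ^ n v) (coords-σ^ n u))

  Invariant⇒unit : ∀ p → Invariant p → IsUnit (fold (1ℤ , 0ℤ) rot p)
  Invariant⇒unit p invariant =
    IsUnit-resp (≋²-trans (difference-σ^ p origin east) (fold-rot-cong p east-origin))
      (to (torus-spec (σ^ p origin) (σ^ p east))
        (subst T (sym (invariant origin east))
          (from (torus-spec origin east) (IsUnit-resp (≋²-sym east-origin) (there (there (here ≋²-refl)))))))
    where
      origin = point (0ℤ , 0ℤ)
      east   = point (1ℤ , 0ℤ)
      east-origin : coords east -² coords origin ≋² (1ℤ , 0ℤ)
      east-origin = -²-cong (coords-point (1ℤ , 0ℤ)) (coords-point (0ℤ , 0ℤ))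

  preserves⇒Invariant : ∀ p → (∀ E → IsUnit (fold E rot p) ⇔ IsUnit E) → Invariant p
  preserves⇒Invariant p preserves u v = T-injective (begin
    T (torus S (σ^ p u) (σ^ p v))                     ≈⟨ torus-spec (σ^ p u) (σ^ p v) ⟩
    IsUnit (coords (σ^ p v) -² coords (σ^ p u))       ≈⟨ mk⇔ (IsUnit-resp moved) (IsUnit-resp (≋²-sym moved)) ⟩
    IsUnit (fold (coords v -² coords u) rot p)        ≈⟨ preserves (coords v -² coords u) ⟩
    IsUnit (coords v -² coords u)                     ≈⟨ Setoid.sym (⇔-setoid _) (torus-spec u v) ⟩
    T (torus S u v)                                   ∎)
    where
      open import Relation.Binary.Reasoning.Setoid (⇔-setoid 0ℓ)
      moved = difference-σ^ p u v

  -- rot² = 2, so rot^(2j) = 2^j and rot^(2j+1) = 2^j · rot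
  rot-even : ∀ j d → fold d rot (2 * j) ≋² + (2 ^ j) · d
  rot-even zero    (p , q) = ≋-reflexive (sym (ℤP.*-identityˡ p)) , ≋-reflexive (sym (ℤP.*-identityˡ q))
  rot-even (suc j) d = subst (λ n → fold d rot n ≋² + (2 ^ suc j) · d) (sym (ℕP.*-suc 2 j)) (begin
    rot (rot (fold d rot (2 * j)))    ≈⟨ rot-cong (rot-cong (rot-even j d)) ⟩
    rot (rot (+ (2 ^ j) · d))         ≡⟨ rot-rot (+ (2 ^ j) · d) ⟩
    + 2 · (+ (2 ^ j) · d)             ≡⟨ ·-assoc (+ 2) (+ (2 ^ j)) d ⟩
    (+ 2 ℤ.* + (2 ^ j)) · d           ≡⟨ cong (_· d) (sym (ℤP.pos-* 2 (2 ^ j))) ⟩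
    + (2 ^ suc j) · d                 ∎)
    where open import Relation.Binary.Reasoning.Setoid ≋²-setoid

  rot-odd : ∀ j d → fold d rot (suc (2 * j)) ≋² + (2 ^ j) · rot d
  rot-odd j d = ≋²-trans (rot-cong (rot-even j d)) (≋²-reflexive (rot-· (+ (2 ^ j)) d))

  -- an odd power of σ sends the edge (0,0)–(1,0) to a diagonal pair
  ¬Invariant-odd : ∀ j → ¬ Invariant (suc (2 * j))
  ¬Invariant-odd j invariant =
    ¬IsUnit-diagonal ≋-refl (IsUnit-resp (rot-odd j (1ℤ , 0ℤ)) (Invariant⇒unit (suc (2 * j)) invariant))

  ±1⇔PowTwoPM1 : ∀ j → (+ (2 ^ j) ≋ 1ℤ ⊎ + (2 ^ j) ≋ -1ℤ) ⇔ PowTwoPM1 S j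
  ±1⇔PowTwoPM1 j = mk⇔ (Sum.map (to minus) (to plus)) (Sum.map (from minus) (from plus))
    where
      minus = ≋⇔∣ (2 ^ j ∸ 1) (trans (ℤP.m-n≡m⊖n (2 ^ j) 1) (ℤP.⊖-≥ (ℕP.m^n>0 2 j)))
      plus  = ≋⇔∣ (2 ^ j + 1) (sym (ℤP.pos-+ (2 ^ j) 1))

  -- rot^(2j) sends (1, 0) to (2^j, 0), a unit vector only if 2^j ≡ ±1
  unit-image : ∀ j → IsUnit (fold (1ℤ , 0ℤ) rot (2 * j)) → + (2 ^ j) ≋ 1ℤ ⊎ + (2 ^ j) ≋ -1ℤ
  unit-image j unit = from-image (IsUnit-resp (rot-even j (1ℤ , 0ℤ)) unit)
    where
      2ʲ = + (2 ^ j)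
      times-zero : 2ʲ ℤ.* 0ℤ ≋ 0ℤ
      times-zero = ≋-reflexive (ℤP.*-zeroʳ 2ʲ)
      times-one : 2ʲ ≋ 2ʲ ℤ.* 1ℤ
      times-one = ≋-reflexive (sym (ℤP.*-identityʳ 2ʲ))
      from-image : IsUnit (2ʲ ℤ.* 1ℤ , 2ʲ ℤ.* 0ℤ) → 2ʲ ≋ 1ℤ ⊎ 2ʲ ≋ -1ℤ
      from-image (here (_ , 2ʲ0≋1))                         = ⊥-elim (1≉0 (≋-trans (≋-sym 2ʲ0≋1) times-zero))
      from-image (there (here (_ , 2ʲ0≋-1)))                 = ⊥-elim (1≉0 (cancel-neg (≋-trans (≋-sym 2ʲ0≋-1) times-zero)))
      from-image (there (there (here (2ʲ1≋1 , _))))          = inj₁ (≋-trans times-one 2ʲ1≋1)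
      from-image (there (there (there (here (2ʲ1≋-1 , _))))) = inj₂ (≋-trans times-one 2ʲ1≋-1)

  -- if 2^j ≡ ±1 then rot^(2j) is multiplication by ±1, which preserves unit vectors
  ±1-preserves : ∀ j → + (2 ^ j) ≋ 1ℤ ⊎ + (2 ^ j) ≋ -1ℤ → ∀ E → IsUnit (fold E rot (2 * j)) ⇔ IsUnit E
  ±1-preserves j (inj₁ 2ʲ≋1) E@(p , q) = mk⇔ (IsUnit-resp image≋E) (IsUnit-resp (≋²-sym image≋E))
    where
      one : ∀ x → + (2 ^ j) ℤ.* x ≋ x
      one x = ≋-trans (*-congʳ x 2ʲ≋1) (≋-reflexive (ℤP.*-identityˡ x))
      image≋E = ≋²-trans (rot-even j E) (one p , one q)
  ±1-preserves j (inj₂ 2ʲ≋-1) E@(p , q) =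
    mk⇔ (λ unit → IsUnit-resp (neg-neg E) (IsUnit-neg (IsUnit-resp image≋-E unit)))
        (IsUnit-resp (≋²-sym image≋-E) ∘ IsUnit-neg)
    where
      minus-one : ∀ x → + (2 ^ j) ℤ.* x ≋ - x
      minus-one x = ≋-trans (*-congʳ x 2ʲ≋-1) (≋-reflexive (ℤP.-1*i≡-i x))
      image≋-E = ≋²-trans (rot-even j E) (minus-one p , minus-one q)
      neg-neg : ∀ E → -² (-² E) ≋² E
      neg-neg (p , q) = ≋-reflexive (ℤP.neg-involutive p) , ≋-reflexive (ℤP.neg-involutive q)

  Invariant-even⇔ : ∀ j → Invariant (2 * j) ⇔ PowTwoPM1 S j
  Invariant-even⇔ j = mk⇔ (to (±1⇔PowTwoPM1 j) ∘ unit-image j ∘ Invariant⇒unit (2 * j))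
                          (preserves⇒Invariant (2 * j) ∘ ±1-preserves j ∘ from (±1⇔PowTwoPM1 j))

  -- the process never reaches a fixed point: G^(t+1) = G^(t) would make the torus σ-invariant
  never-converges : ∀ t → ¬ (process S t ≈G process S (suc t))
  never-converges t same = ¬Invariant-odd 0 (coincidence⇒Invariant 1 t λ u v →
    trans (cong (λ n → process S n u v) (ℕP.+-comm t 1)) (sym (same u v)))

  cycle-size : ∀ k → 0 < k → PowTwoPM1 S k → (∀ j → 0 < j → j < k → ¬ PowTwoPM1 S j) →
               IsCycleSize (process S) (2 * k)
  cycle-size k k>0 2^k≡±1 minimal =
    ℕP.<-≤-trans k>0 (ℕP.m≤m+n k (k + 0)) , Invariant⇒periodic (2 * k) (from (Invariant-even⇔ k) 2^k≡±1) , no-shorter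
    where
      no-shorter : ∀ q → 1 ≤ q → q < 2 * k → ¬ EventuallyPeriodicWith (process S) q
      no-shorter q q≥1 q<2k (T₀ , periodic) = excluded (parity q)
        where
          invariant : Invariant q
          invariant = coincidence⇒Invariant q T₀ (periodic T₀ ℕP.≤-refl)
          excluded : (∃[ j ] q ≡ 2 * j) ⊎ (∃[ j ] q ≡ suc (2 * j)) → ⊥
          excluded (inj₁ (zero , q≡0))  = ℕP.<⇒≢ q≥1 (sym q≡0)
          excluded (inj₁ (suc j , q≡2j)) =
            minimal (suc j) (s≤s z≤n) (ℕP.*-cancelˡ-< 2 (suc j) k (subst (_< 2 * k) q≡2j q<2k))
                    (to (Invariant-even⇔ (suc j)) (subst Invariant q≡2j invariant))
          excluded (inj₂ (j , q≡2j+1)) = ¬Invariant-odd j (subst Invariant q≡2j+1 invariant)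

lemma9 : (S : ℕ) → 3 ≤ S → ¬ (2 ∣ S) →
    (∀ t → ¬ (process S t ≈G process S (suc t)))
    × (∀ k → 0 < k → PowTwoPM1 S k → (∀ j → 0 < j → j < k → ¬ PowTwoPM1 S j) →
    IsCycleSize (process S) (2 * k))
lemma9 S S≥3 S-odd with parity S
... | inj₁ (j , S≡2j)   = ⊥-elim (S-odd (subst (2 ∣_) (sym S≡2j) (m∣m*n j)))
... | inj₂ (j , S≡2j+1) = never-converges , cycle-size
  where
    -- h = j + 1 is the inverse of 2 modulo S = 2j + 1
    2h≡S+1 : 2 * suc j ≡ S + 1
    2h≡S+1 = trans (ℕP.*-suc 2 j) (trans (ℕP.+-comm 1 (suc (2 * j))) (cong (_+ 1) (sym S≡2j+1)))
    open OddTorus S S≥3 (suc j) 2h≡S+1
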